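{- Let $(G,c)$ be a finite bicolored graph in which every connected component of $G$ contains at least one black vertex. Then $(G,c)$ has a successful pressing sequence.
   Context: A bicolored graph is a pair $(G,c)$ with $G$ a finite simple graph and $c:V(G)\to\{\text{black},\text{white}\}$. For a vertex $v$ let $N^\ast(v)=N(v)\cup\{v\}$ be its closed neighborhood. If $v$ is black, "pressing $v$" transforms $(G,c)$ into $(G',c')$ with $V(G')=V(G)$, $E(G')=E(G)\,\triangle\,\binom{N^\ast(v)}{2}$ (i.e., the induced subgraph on $N^\ast(v)$ is complemented), $c'(w)=c(w)$ for $w\notin N^\ast(v)$, and $c'(w)$ equal to the opposite color of $c(w)$ for $w\in N^\ast(v)$. A pressing sequence is a sequence of vertices $v_1,\dots,v_m$ such that each $v_i$ is black in the graph obtained after pressing $v_1,\dots,v_{i-1}$ in turn; it is successful if the graph obtained after pressing all of them has no edges and all vertices white. -}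

module Defs where

open import Data.Nat using (ℕ)
open import Data.Fin using (Fin; _≟_)
open import Data.Bool using (Bool; true; false; not; _∧_; _∨_; _xor_)
open import Data.List using (List; []; _∷_)
open import Data.Product using (Σ; ∃; _×_)
open import Relation.Nullary.Decidable using (⌊_⌋)
open import Relation.Binary.PropositionalEquality using (_≡_)

-- A bicolored graph on vertex set Fin n: adjacency as a Bool-valued
-- function, colour: true = black, false = white.
record BGraph (n : ℕ) : Set where
  constructor bgraph
  field
    adj : Fin n → Fin n → Bool
    col : Fin n → Bool
open BGraph public

IsSimple : {n : ℕ} → BGraph n → Set
IsSimple G = (∀ u w → adj G u w ≡ adj G w u) × (∀ u → adj G u u ≡ false)

inN* : {n : ℕ} → BGraph n → Fin n → Fin n → Bool
inN* G v u = ⌊ v ≟ u ⌋ ∨ adj G v u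

press : {n : ℕ} → BGraph n → Fin n → BGraph n
press G v = bgraph
  (λ u w → adj G u w xor (inN* G v u ∧ inN* G v w ∧ not ⌊ u ≟ w ⌋))
  (λ u → col G u xor inN* G v u)

data Reach {n : ℕ} (G : BGraph n) : Fin n → Fin n → Set where
  here  : ∀ {u} → Reach G u u
  there : ∀ {u v w} → adj G u v ≡ true → Reach G v w → Reach G u w

data Successful {n : ℕ} : BGraph n → List (Fin n) → Set where
  done : ∀ {G} → (∀ u w → adj G u w ≡ false) → (∀ u → col G u ≡ false) →
         Successful G []
  step : ∀ {G v vs} → col G v ≡ true → Successful (press G v) vs →
         Successful G (v ∷ vs)

module Submission where

-- Call a set S of vertices a trap if no edge leaves S, every vertex of S is
-- white, and S spans an edge; this is the obstruction to be avoided, and the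
-- proof keeps the graph trap-free while pressing.  The hypothesis implies
-- that G is trap-free (a trap would contain a whole component, hence a black
-- vertex).
--
-- The heart of the proof is the good-vertex lemma: a trap-free simple graph
-- with a black vertex has a black vertex v such that pressing v leaves the
-- graph trap-free.  Starting from any black v, if pressing v creates a trap C
-- then C contains a black neighbour u of v, and either u is isolated after
-- the press (so C - u is a smaller trap for v), or pressing u is safe, or
-- every trap D created by pressing u yields the strictly smaller trap
-- (D ∩ C) - u for u.  Induction on the size of the trap finds a good vertex.
--
-- Finally, pressing a black vertex never activates a white isolated vertex
-- and deactivates the pressed one, so repeatedly pressing good vertices ends
-- in a trap-free graph without black vertices, which has no edges.

open import Defs
open import Data.Nat using (ℕ; _<_)
open import Data.Nat.Induction using (<-wellFounded)
open import Induction.WellFounded using (Acc; acc)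
open import Data.Fin using (Fin; zero; suc; _≟_)
open import Data.Fin.Properties using (any?; all?)
open import Data.Fin.Subset using (Subset; _∈_; _∉_; _∩_; _-_; ⁅_⁆; ⊤; ∁; ∣_∣)
open import Data.Fin.Subset.Properties
  using (_∈?_; anySubset?; ∈⊤; p⊂q⇒∣p∣<∣q∣; x∈p⇒∣p-x∣<∣p∣; p─q⊆p; p∩q⊆q;
         x∈p∩q⁺; x∈p∩q⁻; x∈p∧x≢y⇒x∈p-y; x∈∁p⇒x∉p; x∉p⇒x∈∁p; x∉∁p⇒x∈p)
open import Data.Vec using (_∷_; tabulate; there)
open import Data.Vec.Properties using (lookup∘tabulate; []=⇒lookup; lookup⇒[]=)
open import Data.Bool using (Bool; true; false; _∧_; _xor_) renaming (_≟_ to _≟ᵇ_)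
open import Data.Bool.Properties using (¬-not; xor-same; xor-identityʳ; ∧-comm; ∧-identityʳ; ∧-zeroʳ; ∨-zeroʳ)
open import Data.List using (List; []; _∷_)
open import Data.Product using (∃; _×_; _,_; proj₁; proj₂)
open import Data.Empty using (⊥-elim)
open import Function using (_∘_)
open import Relation.Nullary using (¬_; Dec; yes; no; contradiction)
open import Relation.Nullary.Decidable using (⌊_⌋; isYes; dec-yes; dec-no; map′; ¬?; _×-dec_; _→-dec_)
open import Relation.Binary.PropositionalEquality
  using (_≡_; _≢_; refl; sym; trans; cong; cong₂; module ≡-Reasoning)
open ≡-Reasoning

clash : ∀ {A : Set} {b : Bool} → b ≡ true → b ≡ false → A
clash refl ()

xor≡false⇒≡ : ∀ p q → p xor q ≡ false → p ≡ q
xor≡false⇒≡ false false _ = refl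
xor≡false⇒≡ true  true  _ = refl

module _ {n : ℕ} where

  ⌊≟⌋-refl : (x : Fin n) → ⌊ x ≟ x ⌋ ≡ true
  ⌊≟⌋-refl x = cong isYes (proj₂ (dec-yes (x ≟ x) refl))

  ⌊≟⌋-≢ : {x y : Fin n} → x ≢ y → ⌊ x ≟ y ⌋ ≡ false
  ⌊≟⌋-≢ {x} {y} x≢y = cong isYes (dec-no (x ≟ y) x≢y)

  ∈∉⇒≢ : {S : Subset n} {x y : Fin n} → x ∈ S → y ∉ S → x ≢ y
  ∈∉⇒≢ x∈S y∉S refl = y∉S x∈S

x∉p-x : ∀ {n} (p : Subset n) (x : Fin n) → x ∉ p - x
x∉p-x (_ ∷ p) zero    ()
x∉p-x (_ ∷ p) (suc x) (there x∈p-x) = x∉p-x p x x∈p-x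

x∈p-y⇒x≢y : ∀ {n} {p : Subset n} {x y : Fin n} → x ∈ p - y → x ≢ y
x∈p-y⇒x≢y {p = p} x∈p-y refl = x∉p-x p _ x∈p-y

module _ {n : ℕ} (G : BGraph n) where

  inN*-self : ∀ v → inN* G v v ≡ true
  inN*-self v rewrite ⌊≟⌋-refl v = refl

  inN*-adj : ∀ {v u} → adj G v u ≡ true → inN* G v u ≡ true
  inN*-adj {v} {u} vu rewrite vu = ∨-zeroʳ ⌊ v ≟ u ⌋

  inN*-≢ : ∀ {v u} → v ≢ u → inN* G v u ≡ adj G v u
  inN*-≢ v≢u rewrite ⌊≟⌋-≢ v≢u = refl

  press-adj : ∀ v {x y} → x ≢ y → adj (press G v) x y ≡ adj G x y xor (inN* G v x ∧ inN* G v y)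
  press-adj v {x} {y} x≢y rewrite ⌊≟⌋-≢ x≢y =
    cong (λ t → adj G x y xor (inN* G v x ∧ t)) (∧-identityʳ (inN* G v y))

  press-loop : ∀ v x → adj (press G v) x x ≡ adj G x x
  press-loop v x rewrite ⌊≟⌋-refl x | ∧-zeroʳ (inN* G v x) | ∧-zeroʳ (inN* G v x) = xor-identityʳ (adj G x x)

  press-untouched : ∀ {v x} → inN* G v x ≡ false →
                    col (press G v) x ≡ col G x × (∀ y → adj (press G v) x y ≡ adj G x y)
  press-untouched {v} {x} x∉N* rewrite x∉N* = xor-identityʳ (col G x) , λ y → xor-identityʳ (adj G x y)

  press-whitens : ∀ {v} → col G v ≡ true → col (press G v) v ≡ false
  press-whitens {v} black rewrite black | inN*-self v = refl

module Pressing {n : ℕ} {G : BGraph n} (simple : IsSimple G) where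

  press-sym : ∀ v x y → adj (press G v) x y ≡ adj (press G v) y x
  press-sym v x y = by-cases (x ≟ y)
    where
    by-cases : Dec (x ≡ y) → adj (press G v) x y ≡ adj (press G v) y x
    by-cases (yes refl) = refl
    by-cases (no x≢y) = begin
      adj (press G v) x y                             ≡⟨ press-adj G v x≢y ⟩
      adj G x y xor (inN* G v x ∧ inN* G v y)         ≡⟨ cong₂ _xor_ (proj₁ simple x y) (∧-comm (inN* G v x) _) ⟩
      adj G y x xor (inN* G v y ∧ inN* G v x)         ≡⟨ press-adj G v (x≢y ∘ sym) ⟨
      adj (press G v) y x                             ∎

  press-simple : ∀ v → IsSimple (press G v)
  press-simple v = press-sym v , λ x → trans (press-loop G v x) (proj₂ simple x)

  press-isolates : ∀ v y → adj (press G v) v y ≡ false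
  press-isolates v y = by-cases (v ≟ y)
    where
    by-cases : Dec (v ≡ y) → adj (press G v) v y ≡ false
    by-cases (yes refl) = proj₂ (press-simple v) v
    by-cases (no v≢y) = begin
      adj (press G v) v y                             ≡⟨ press-adj G v v≢y ⟩
      adj G v y xor (inN* G v v ∧ inN* G v y)         ≡⟨ cong₂ (λ p q → adj G v y xor (p ∧ q)) (inN*-self G v) (inN*-≢ G v≢y) ⟩
      adj G v y xor adj G v y                         ≡⟨ xor-same (adj G v y) ⟩
      false                                           ∎

record Trap {n : ℕ} (G : BGraph n) (S : Subset n) : Set where
  field
    white    : ∀ {x} → x ∈ S → col G x ≡ false
    closed   : ∀ {x y} → x ∈ S → y ∉ S → adj G x y ≡ false
    src tgt  : Fin n
    src∈S    : src ∈ S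
    tgt∈S    : tgt ∈ S
    edge     : adj G src tgt ≡ true
open Trap

TrapFree : {n : ℕ} → BGraph n → Set
TrapFree {n} G = (S : Subset n) → ¬ Trap G S

trap? : {n : ℕ} (G : BGraph n) (S : Subset n) → Dec (Trap G S)
trap? G S = map′ fromParts toParts (white? ×-dec closed? ×-dec edge?)
  where
  Whites Closed Edge : Set
  Whites = ∀ x → x ∈ S → col G x ≡ false
  Closed = ∀ x y → x ∈ S → y ∉ S → adj G x y ≡ false
  Edge   = ∃ λ x → ∃ λ y → x ∈ S × y ∈ S × adj G x y ≡ true

  white? : Dec Whites
  white? = all? λ x → (x ∈? S) →-dec (col G x ≟ᵇ false)
  closed? : Dec Closed
  closed? = all? λ x → all? λ y → (x ∈? S) →-dec (¬? (y ∈? S) →-dec (adj G x y ≟ᵇ false))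
  edge? : Dec Edge
  edge? = any? λ x → any? λ y → (x ∈? S) ×-dec (y ∈? S) ×-dec (adj G x y ≟ᵇ true)

  fromParts : Whites × Closed × Edge → Trap G S
  fromParts (w , c , x , y , x∈S , y∈S , e) =
    record { white = w _ ; closed = c _ _ ; src∈S = x∈S ; tgt∈S = y∈S ; edge = e }
  toParts : Trap G S → Whites × Closed × Edge
  toParts t = (λ _ → white t) , (λ _ _ → closed t) , src t , tgt t , src∈S t , tgt∈S t , edge t

module _ {n : ℕ} {H : BGraph n} where

  trap-minus-isolated : (∀ x y → adj H x y ≡ adj H y x) → ∀ {S} z →
                        (∀ y → adj H z y ≡ false) → Trap H S → Trap H (S - z)
  trap-minus-isolated sym-H {S} z isolated t = record
    { white  = white t ∘ inS
    ; closed = closedMinus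
    ; src∈S  = x∈p∧x≢y⇒x∈p-y (src∈S t) λ { refl → clash (edge t) (isolated (tgt t)) }
    ; tgt∈S  = x∈p∧x≢y⇒x∈p-y (tgt∈S t) λ { refl → clash (trans (sym-H _ _) (edge t)) (isolated (src t)) }
    ; edge   = edge t
    }
    where
    inS : ∀ {x} → x ∈ S - z → x ∈ S
    inS = p─q⊆p S ⁅ z ⁆
    closedMinus : ∀ {x y} → x ∈ S - z → y ∉ S - z → adj H x y ≡ false
    closedMinus {x} {y} x∈ y∉ with y ≟ z | y ∈? S
    ... | yes refl | _       = trans (sym-H x y) (isolated x)
    ... | no y≢z   | yes y∈S = contradiction (x∈p∧x≢y⇒x∈p-y y∈S y≢z) y∉
    ... | no _     | no y∉S  = closed t (inS x∈) y∉S

  trap-∩ : ∀ {S T} → Trap H S →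
           (∀ {x y} → x ∈ S → x ∈ T → y ∈ S → y ∉ T → adj H x y ≡ false) →
           ∀ {x y} → x ∈ S → x ∈ T → y ∈ S → y ∈ T → adj H x y ≡ true → Trap H (S ∩ T)
  trap-∩ {S} {T} t uncrossed x∈S x∈T y∈S y∈T e = record
    { white  = white t ∘ proj₁ ∘ x∈p∩q⁻ S T
    ; closed = closedCut
    ; src∈S  = x∈p∩q⁺ (x∈S , x∈T)
    ; tgt∈S  = x∈p∩q⁺ (y∈S , y∈T)
    ; edge   = e
    }
    where
    closedCut : ∀ {x y} → x ∈ S ∩ T → y ∉ S ∩ T → adj H x y ≡ false
    closedCut x∈ y∉ with x∈p∩q⁻ S T x∈ | _ ∈? S | _ ∈? T
    ... | x∈S′ , _    | no y∉S  | _       = closed t x∈S′ y∉S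
    ... | x∈S′ , x∈T′ | yes y∈S | no y∉T  = uncrossed x∈S′ x∈T′ y∈S y∉T
    ... | _           | yes y∈S | yes y∈T = contradiction (x∈p∩q⁺ (y∈S , y∈T)) y∉

module _ {n : ℕ} {G : BGraph n} where

  trap-untouched : ∀ {v S} → Trap (press G v) S → (∀ {x} → x ∈ S → inN* G v x ≡ false) → Trap G S
  trap-untouched {v} {S} t avoids = record
    { white  = λ x∈S → trans (sym (colKept x∈S)) (white t x∈S)
    ; closed = λ x∈S y∉S → trans (sym (adjKept x∈S _)) (closed t x∈S y∉S)
    ; src∈S  = src∈S t
    ; tgt∈S  = tgt∈S t
    ; edge   = trans (sym (adjKept (src∈S t) (tgt t))) (edge t)
    }
    where
    colKept : ∀ {x} → x ∈ S → col (press G v) x ≡ col G x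
    colKept x∈S = proj₁ (press-untouched G (avoids x∈S))
    adjKept : ∀ {x} → x ∈ S → ∀ y → adj (press G v) x y ≡ adj G x y
    adjKept x∈S = proj₂ (press-untouched G (avoids x∈S))

  closed-reach : ∀ {S} → (∀ {x y} → x ∈ S → y ∉ S → adj G x y ≡ false) →
                 ∀ {u w} → Reach G u w → u ∈ S → w ∈ S
  closed-reach closedS here u∈S = u∈S
  closed-reach {S} closedS (there {v = v} e walk) u∈S with v ∈? S
  ... | yes v∈S = closed-reach closedS walk v∈S
  ... | no v∉S  = clash e (closedS u∈S v∉S)

  -- If every component contains a black vertex, there is no trap: a trap
  -- contains the whole component of its edge, and so a black vertex.
  black-components⇒trapFree : (∀ u → ∃ λ w → Reach G u w × col G w ≡ true) → TrapFree G
  black-components⇒trapFree blackIn S t with blackIn (src t)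
  ... | w , walk , black = clash black (white t (closed-reach (closed t) walk (src∈S t)))

  -- A trap-free graph without black vertices has no edges: otherwise the
  -- whole vertex set would be a trap.
  trapFree-white⇒edgeless : TrapFree G → (∀ x → col G x ≡ false) → ∀ x y → adj G x y ≡ false
  trapFree-white⇒edgeless free allWhite x y = ¬-not λ e → free ⊤ record
    { white  = λ _ → allWhite _
    ; closed = λ _ y∉⊤ → contradiction ∈⊤ y∉⊤
    ; src∈S  = ∈⊤
    ; tgt∈S  = ∈⊤
    ; edge   = e
    }

module GoodVertex {n : ℕ} {G : BGraph n} (simple : IsSimple G) (free : TrapFree G) where

  open Pressing {G = G} simple

  Good : Fin n → Set
  Good v = col G v ≡ true × TrapFree (press G v)

  -- A trap C created by pressing v contains a neighbour u of v, and u was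
  -- black before the press (it is white afterwards and lies in N*(v)).
  -- Otherwise C - v would avoid N*(v), so it would be a trap already in G.
  trap-meets-neighbour : ∀ {v C} → Trap (press G v) C →
                         ∃ λ u → u ∈ C × adj G v u ≡ true × col G u ≡ true
  trap-meets-neighbour {v} {C} t with any? (λ u → (u ∈? C) ×-dec (adj G v u ≟ᵇ true))
  ... | yes (u , u∈C , vu) = u , u∈C , vu , trans (xor≡false⇒≡ _ _ (white t u∈C)) (inN*-adj G vu)
  ... | no noNeighbour = ⊥-elim (
    free (C - v) (trap-untouched {G = G} (trap-minus-isolated {H = press G v} (press-sym v) v (press-isolates v) t) avoids))
    where
    avoids : ∀ {x} → x ∈ C - v → inN* G v x ≡ false
    avoids {x} x∈ = trans (inN*-≢ G (x∈p-y⇒x≢y x∈ ∘ sym))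
                          (¬-not λ vx → noNeighbour (x , p─q⊆p C ⁅ v ⁆ x∈ , vx))

  module Descent {v u z : Fin n} {C D : Subset n}
                 (vu : adj G v u ≡ true) (trapC : Trap (press G v) C) (u∈C : u ∈ C)
                 (uz : adj (press G v) u z ≡ true) (trapD : Trap (press G u) D) where

    a b : Fin n → Bool
    a = inN* G v
    b = inN* G u

    a-u : a u ≡ true
    a-u = inN*-adj G vu

    -- Since no edge leaves C after the press, the edges of G between C and
    -- its complement are exactly the pairs inside N*(v).
    across-C : ∀ {x y} → x ∈ C → y ∉ C → adj G x y ≡ a x ∧ a y
    across-C x∈C y∉C = xor≡false⇒≡ _ _
      (trans (sym (press-adj G v (∈∉⇒≢ x∈C y∉C))) (closed trapC x∈C y∉C))

    b≡a-outside-C : ∀ {y} → y ∉ C → b y ≡ a y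
    b≡a-outside-C {y} y∉C = begin
      b y          ≡⟨ inN*-≢ G (∈∉⇒≢ u∈C y∉C) ⟩
      adj G u y    ≡⟨ across-C u∈C y∉C ⟩
      a u ∧ a y    ≡⟨ cong (_∧ a y) a-u ⟩
      a y          ∎

    -- On C ∩ D, both presses whiten the vertex, so N*(u) and N*(v) agree.
    a≡b-on-C∩D : ∀ {x} → x ∈ C → x ∈ D → a x ≡ b x
    a≡b-on-C∩D x∈C x∈D =
      trans (sym (xor≡false⇒≡ (col G _) (a _) (white trapC x∈C))) (xor≡false⇒≡ (col G _) (b _) (white trapD x∈D))

    no-edge-C∩D-∁C : ∀ {x y} → x ∈ C → x ∈ D → y ∉ C → adj (press G u) x y ≡ false
    no-edge-C∩D-∁C {x} {y} x∈C x∈D y∉C = begin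
      adj (press G u) x y          ≡⟨ press-adj G u (∈∉⇒≢ x∈C y∉C) ⟩
      adj G x y xor (b x ∧ b y)    ≡⟨ cong₂ _xor_ (across-C x∈C y∉C)
                                        (cong₂ _∧_ (sym (a≡b-on-C∩D x∈C x∈D)) (b≡a-outside-C y∉C)) ⟩
      (a x ∧ a y) xor (a x ∧ a y)  ≡⟨ xor-same (a x ∧ a y) ⟩
      false                        ∎

    z∈C : z ∈ C
    z∈C with z ∈? C
    ... | yes z∈C = z∈C
    ... | no z∉C  = clash uz (closed trapC u∈C z∉C)

    u≢z : u ≢ z
    u≢z refl = clash uz (proj₂ (press-simple v) u)

    a≢b-at-z : a z ≢ b z
    a≢b-at-z az≡bz = clash uz (begin
      adj (press G v) u z          ≡⟨ press-adj G v u≢z ⟩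
      adj G u z xor (a u ∧ a z)    ≡⟨ cong₂ _xor_ (sym (inN*-≢ G u≢z)) (cong (_∧ a z) a-u) ⟩
      b z xor a z                  ≡⟨ cong (b z xor_) az≡bz ⟩
      b z xor b z                  ≡⟨ xor-same (b z) ⟩
      false                        ∎)

    z∉D : z ∉ D
    z∉D z∈D = a≢b-at-z (a≡b-on-C∩D z∈C z∈D)

    -- The part of D outside C avoids N*(u); otherwise the edge from it to z
    -- after pressing u would leave the trap D.
    D-∁C-avoids-N*u : ∀ {y} → y ∈ D → y ∉ C → b y ≡ false
    D-∁C-avoids-N*u {y} y∈D y∉C = ¬-not λ b-y → a≢b-at-z (xor≡false⇒≡ _ _ (begin
      a z xor b z                  ≡⟨ cong₂ _xor_ (sym (adj-yz b-y)) (cong (_∧ b z) (sym b-y)) ⟩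
      adj G y z xor (b y ∧ b z)    ≡⟨ press-adj G u (∈∉⇒≢ y∈D z∉D) ⟨
      adj (press G u) y z          ≡⟨ closed trapD y∈D z∉D ⟩
      false                        ∎))
      where
      adj-yz : b y ≡ true → adj G y z ≡ a z
      adj-yz b-y = begin
        adj G y z    ≡⟨ proj₁ simple y z ⟩
        adj G z y    ≡⟨ across-C z∈C y∉C ⟩
        a z ∧ a y    ≡⟨ cong (a z ∧_) (trans (sym (b≡a-outside-C y∉C)) b-y) ⟩
        a z ∧ true   ≡⟨ ∧-identityʳ (a z) ⟩
        a z          ∎

    -- The edge of D lies inside C (an edge inside D outside C would give a
    -- trap of G, and D has no edge across C), so (D ∩ C) - u is a trap.
    smaller-trap : Trap (press G u) ((D ∩ C) - u)
    smaller-trap with src trapD ∈? C | tgt trapD ∈? C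
    ... | yes x∈C | yes y∈C =
      trap-minus-isolated (press-sym u) u (press-isolates u)
        (trap-∩ trapD (λ x∈D x∈C y∈D y∉C → no-edge-C∩D-∁C x∈C x∈D y∉C)
                (src∈S trapD) x∈C (tgt∈S trapD) y∈C (edge trapD))
    ... | yes x∈C | no y∉C = clash (edge trapD) (no-edge-C∩D-∁C x∈C (src∈S trapD) y∉C)
    ... | no x∉C  | yes y∈C =
      clash (trans (press-sym u _ _) (edge trapD)) (no-edge-C∩D-∁C y∈C (tgt∈S trapD) x∉C)
    ... | no x∉C  | no y∉C = ⊥-elim (free (D ∩ ∁ C)
      (trap-untouched {G = G}
        (trap-∩ trapD noCrossing (src∈S trapD) (x∉p⇒x∈∁p x∉C) (tgt∈S trapD) (x∉p⇒x∈∁p y∉C) (edge trapD))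
        (λ w∈ → let (w∈D , w∈∁C) = x∈p∩q⁻ D (∁ C) w∈ in D-∁C-avoids-N*u w∈D (x∈∁p⇒x∉p w∈∁C))))
      where
      noCrossing : ∀ {x y} → x ∈ D → x ∈ ∁ C → y ∈ D → y ∉ ∁ C → adj (press G u) x y ≡ false
      noCrossing x∈D x∈∁C y∈D y∉∁C =
        trans (press-sym u _ _) (no-edge-C∩D-∁C (x∉∁p⇒x∈p y∉∁C) y∈D (x∈∁p⇒x∉p x∈∁C))

    -- The new trap lies in C and misses u ∈ C.
    smaller-size : ∣ (D ∩ C) - u ∣ < ∣ C ∣
    smaller-size = p⊂q⇒∣p∣<∣q∣ (p∩q⊆q D C ∘ p─q⊆p (D ∩ C) ⁅ u ⁆ , u , u∈C , x∉p-x (D ∩ C) u)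

  search : ∀ v → col G v ≡ true → ∀ C → Trap (press G v) C → Acc _<_ ∣ C ∣ → ∃ Good
  search v v-black C trapC (acc below) with trap-meets-neighbour trapC
  ... | u , u∈C , vu , u-black with any? (λ z → adj (press G v) u z ≟ᵇ true)
  ...   | no u-isolated =
    search v v-black (C - u)
      (trap-minus-isolated (press-sym v) u (λ y → ¬-not λ e → u-isolated (y , e)) trapC)
      (below (x∈p⇒∣p-x∣<∣p∣ u∈C))
  ...   | yes (z , uz) with anySubset? (trap? (press G u))
  ...     | no noTrap = u , u-black , λ D trapD → noTrap (D , trapD)
  ...     | yes (D , trapD) =
    search u u-black ((D ∩ C) - u) (Descent.smaller-trap vu trapC u∈C uz trapD)
      (below (Descent.smaller-size vu trapC u∈C uz trapD))

  good-vertex : ∀ w → col G w ≡ true → ∃ Good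
  good-vertex w w-black with anySubset? (trap? (press G w))
  ... | no noTrap = w , w-black , λ C trapC → noTrap (C , trapC)
  ... | yes (C , trapC) = search w w-black C trapC (<-wellFounded ∣ C ∣)

Inactive : {n : ℕ} → BGraph n → Fin n → Set
Inactive {n} G x = col G x ≡ false × ((y : Fin n) → adj G x y ≡ false)

inactive? : {n : ℕ} (G : BGraph n) (x : Fin n) → Dec (Inactive G x)
inactive? G x = (col G x ≟ᵇ false) ×-dec all? (λ y → adj G x y ≟ᵇ false)

-- The set of active vertices, whose size measures the remaining work.
active : {n : ℕ} → BGraph n → Subset n
active G = tabulate λ x → ⌊ ¬? (inactive? G x) ⌋

module _ {n : ℕ} {G : BGraph n} {x : Fin n} where

  active⁺ : ¬ Inactive G x → x ∈ active G
  active⁺ notInactive = lookup⇒[]= x (active G)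
    (trans (lookup∘tabulate _ x) (cong isYes (proj₂ (dec-yes (¬? (inactive? G x)) notInactive))))

  active⁻ : x ∈ active G → ¬ Inactive G x
  active⁻ x∈ inactiveX = clash (trans (sym (lookup∘tabulate _ x)) ([]=⇒lookup x∈))
    (cong isYes (dec-no (¬? (inactive? G x)) (λ notInactive → notInactive inactiveX)))

module _ {n : ℕ} {G : BGraph n} (simple : IsSimple G) {v : Fin n} (v-black : col G v ≡ true) where

  open Pressing {G = G} simple

  -- An inactive vertex lies outside N*(v), so pressing v leaves it inactive.
  inactive-press : ∀ {x} → Inactive G x → Inactive (press G v) x
  inactive-press {x} (x-white , x-isolated) =
    trans (proj₁ untouched) x-white , λ y → trans (proj₂ untouched y) (x-isolated y)
    where
    v≢x : v ≢ x
    v≢x refl = clash v-black x-white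
    untouched : col (press G v) x ≡ col G x × (∀ y → adj (press G v) x y ≡ adj G x y)
    untouched = press-untouched G (trans (inN*-≢ G v≢x) (trans (proj₁ simple v x) (x-isolated v)))

  active-shrinks : ∣ active (press G v) ∣ < ∣ active G ∣
  active-shrinks = p⊂q⇒∣p∣<∣q∣
    ( (λ x∈ → active⁺ (active⁻ x∈ ∘ inactive-press))
    , v , active⁺ (λ v-inactive → clash v-black (proj₁ v-inactive))
    , λ v∈ → active⁻ v∈ (press-whitens G v-black , press-isolates v))

press-to-empty : {n : ℕ} (G : BGraph n) → IsSimple G → TrapFree G → Acc _<_ ∣ active G ∣ →
                 ∃ λ vs → Successful G vs
press-to-empty G simple free (acc below) with any? (λ x → col G x ≟ᵇ true)
... | yes (w , w-black) with GoodVertex.good-vertex simple free w w-black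
...   | v , v-black , free′
      with press-to-empty (press G v) (Pressing.press-simple {G = G} simple v) free′
                          (below (active-shrinks simple v-black))
...     | vs , pressed = v ∷ vs , step v-black pressed
press-to-empty G simple free _ | no noBlack =
  [] , done (trapFree-white⇒edgeless free allWhite) allWhite
  where
  allWhite : ∀ x → col G x ≡ false
  allWhite x = ¬-not λ black → noBlack (x , black)

proposition1 : (n : ℕ) (G : BGraph n) → IsSimple G →
    (∀ u → ∃ λ w → Reach G u w × col G w ≡ true) →
    ∃ λ (vs : List (Fin n)) → Successful G vs
proposition1 n G simple blackComponents =
  press-to-empty G simple (black-components⇒trapFree blackComponents) (<-wellFounded _)
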